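{- Let $k\in\mathbb{N}$, let $\mathbf{X},\mathbf{A}$ be finite $\sigma$-structures, and suppose that there is a homomorphism $\mathbf{X}^{\otimes k}\to\mathbb{F}_{\mathscr{Q}_{\mathrm{conv}}}(\mathbf{A}^{\otimes k})$. Then there exists a homomorphism $\bar g:\mathbf{X}^{\otimes k}\to\mathbb{F}_{\mathscr{Q}_{\mathrm{conv}}}(\mathbf{A}^{\otimes k})$ such that $\bar g(\mathbf{x})(\mathbf{a})=\bar g(\mathbf{x})(\vartheta(\mathbf{a}))$ for every $\mathbf{x}\in X^k$, $\mathbf{a}\in A^k$ and every automorphism $\vartheta$ of $\mathbf{A}$ (applied to $\mathbf{a}$ coordinatewise).
   Context: A $\sigma$-structure $\mathbf{A}$ has domain $A$ and relations $R^{\mathbf{A}}\subseteq A^{\mathrm{ar}(R)}$; homomorphisms preserve all relations coordinatewise; an automorphism of $\mathbf{A}$ is a bijective homomorphism $\mathbf{A}\to\mathbf{A}$ whose inverse is a homomorphism. For $\mathbf{a}=(a_1,\dots,a_r)$ and $\mathbf{i}=(i_1,\dots,i_k)\in[r]^k$, $\mathbf{a}_{\mathbf{i}}=(a_{i_1},\dots,a_{i_k})$. Tensor power: $\mathbf{A}^{\otimes k}$ has the same symbols, where $R$ of arity $r$ gets arity $r^k$ with positions indexed by $[r]^k$; domain $A^k$; $R^{\mathbf{A}^{\otimes k}}=\{\mathbf{a}^{\otimes k}:\mathbf{a}\in R^{\mathbf{A}}\}$ with $\mathbf{a}^{\otimes k}$ the family whose $\mathbf{i}$-th entry is $\mathbf{a}_{\mathbf{i}}\in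 A^k$. Maps are applied to such families entrywise. $\mathbb{F}_{\mathscr{Q}_{\mathrm{conv}}}(\mathbf{A}^{\otimes k})$: domain is the set of nonnegative rational tensors indexed by $A^k$ with entries summing to $1$ ($T(\mathbf{a})$ is the $\mathbf{a}$-entry); a family $(M_{\mathbf{i}})_{\mathbf{i}\in[r]^k}$ is in $R^{\mathbb{F}_{\mathscr{Q}_{\mathrm{conv}}}(\mathbf{A}^{\otimes k})}$ iff there is a rational probability vector $q$ on $R^{\mathbf{A}}$ with $M_{\mathbf{i}}(\mathbf{a})=\sum_{\mathbf{b}\in R^{\mathbf{A}},\,\mathbf{b}_{\mathbf{i}}=\mathbf{a}}q(\mathbf{b})$ for all $\mathbf{i}\in[r]^k$, $\mathbf{a}\in A^k$. -}

module Defs where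

open import Data.Nat using (ℕ; zero; suc)
open import Data.Fin using (Fin)
open import Data.Fin.Properties using () renaming (_≟_ to _≟ᶠ_)
open import Data.Vec using (Vec; []; _∷_; map; lookup)
open import Data.Vec.Properties using (≡-dec)
open import Data.List using (List; []; _∷_; length; concatMap; allFin) renaming (map to lmap; lookup to llookup)
open import Data.List.Membership.Propositional using (_∈_)
open import Data.Rational using (ℚ; 0ℚ; 1ℚ; _+_; _≤_)
open import Data.Product using (Σ; _×_)
open import Relation.Nullary using (yes; no)
open import Relation.Binary.PropositionalEquality using (_≡_)

record Signature : Set where
  field
    nsym : ℕ
    arity : Fin nsym → ℕ
open Signature public

record Structure (σ : Signature) : Set where
  field
    size : ℕ
    rel  : (R : Fin (nsym σ)) → List (Vec (Fin size) (arity σ R))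
open Structure public

IsHom : {σ : Signature} (A B : Structure σ) → (Fin (size A) → Fin (size B)) → Set
IsHom {σ} A B h = (R : Fin (nsym σ)) (b : Vec (Fin (size A)) (arity σ R)) →
  b ∈ rel A R → map h b ∈ rel B R

record IsAutomorphism {σ : Signature} (A : Structure σ) (θ : Fin (size A) → Fin (size A)) : Set where
  field
    inv     : Fin (size A) → Fin (size A)
    left    : (a : Fin (size A)) → inv (θ a) ≡ a
    right   : (a : Fin (size A)) → θ (inv a) ≡ a
    hom     : IsHom A A θ
    inv-hom : IsHom A A inv

sumℚ : List ℚ → ℚ
sumℚ []       = 0ℚ
sumℚ (x ∷ xs) = x + sumℚ xs

allVecs : (k n : ℕ) → List (Vec (Fin n) k)
allVecs zero    n = [] ∷ []
allVecs (suc k) n = concatMap (λ a → lmap (a ∷_) (allVecs k n)) (allFin n)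

proj : {B : Set} {r k : ℕ} → Vec B r → Vec (Fin r) k → Vec B k
proj a i = map (lookup a) i

-- Domain of F_{Q_conv}(A^{⊗k}): nonnegative rational tensors indexed by A^k summing to 1
record Tensor (k n : ℕ) : Set where
  field
    entry  : Vec (Fin n) k → ℚ
    nonneg : (a : Vec (Fin n) k) → 0ℚ ≤ entry a
    total  : sumℚ (lmap entry (allVecs k n)) ≡ 1ℚ
open Tensor public

record ProbVec (m : ℕ) : Set where
  field
    weight : Fin m → ℚ
    pnonneg : (j : Fin m) → 0ℚ ≤ weight j
    ptotal : sumℚ (lmap weight (allFin m)) ≡ 1ℚ
open ProbVec public

marginal : {σ : Signature} (A : Structure σ) (k : ℕ) (R : Fin (nsym σ)) →
  ProbVec (length (rel A R)) → Vec (Fin (arity σ R)) k → Vec (Fin (size A)) k → ℚ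
marginal A k R q i a = sumℚ (lmap term (allFin (length (rel A R))))
  where
  term : Fin (length (rel A R)) → ℚ
  term j with ≡-dec _≟ᶠ_ (proj (llookup (rel A R) j) i) a
  ... | yes _ = weight q j
  ... | no  _ = 0ℚ

-- relation R of F_{Q_conv}(A^{⊗k}), a family indexed by [r]^k
InRelF : {σ : Signature} (A : Structure σ) (k : ℕ) (R : Fin (nsym σ)) →
  (Vec (Fin (arity σ R)) k → Tensor k (size A)) → Set
InRelF {σ} A k R M = Σ (ProbVec (length (rel A R))) λ q →
  (i : Vec (Fin (arity σ R)) k) (a : Vec (Fin (size A)) k) → entry (M i) a ≡ marginal A k R q i a

-- homomorphisms X^{⊗k} → F_{Q_conv}(A^{⊗k}); tuples of X^{⊗k} in R are x^{⊗k} for x ∈ R^X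
IsHomTensorF : {σ : Signature} (k : ℕ) (X A : Structure σ) →
  (Vec (Fin (size X)) k → Tensor k (size A)) → Set
IsHomTensorF {σ} k X A g = (R : Fin (nsym σ)) (x : Vec (Fin (size X)) (arity σ R)) →
  x ∈ rel X R → InRelF A k R (λ i → g (proj x i))

{-# OPTIONS --safe #-}

-- Average g over all endomorphisms v of A: ḡ(x) is the uniform mixture of the
-- pushforwards of g(x) along a ↦ v ∘ a. The pushforward of a marginal of q is the
-- marginal of q pushed along b ↦ v ∘ b, which maps R^A into itself because v is a
-- homomorphism, and a mixture of marginals is the marginal of the mixture; so ḡ is a
-- homomorphism. An automorphism θ permutes the endomorphisms by v ↦ θ ∘ v, and θ ∘ -
-- is injective on A^k, whence ḡ(x)(θ a) = ḡ(x)(a). Averaging over End A rather than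
-- Aut A suffices because only this invariance of End A is used.
module Submission where

open import Defs
open import Algebra.Bundles using (CommutativeRing)
open import Data.Bool using (if_then_else_)
open import Data.Fin using (Fin; zero; suc)
open import Data.Fin.Properties using (all?) renaming (_≟_ to _≟ᶠ_)
open import Data.List as List using (List; []; _∷_; _++_; concatMap; allFin; length)
open import Data.List.Membership.Propositional using (_∈_)
open import Data.List.Membership.Propositional.Properties using (∈-lookup)
import Data.List.Relation.Unary.All as All
import Data.List.Relation.Unary.Any as Any
import Data.List.Relation.Unary.Any.Properties as Any
import Data.List.Properties as List
open import Data.Nat using (ℕ)
open import Data.Product using (Σ; _×_; _,_; proj₁; proj₂)
open import Data.Rational using (ℚ; 0ℚ; 1ℚ; _+_; _*_; _≤_; 1/_; NonZero; Positive; positive; nonNegative)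
open import Data.Rational.Properties
  using (+-identityˡ; +-identityʳ; +-assoc; +-mono-≤; *-identityˡ; *-identityʳ; *-zeroˡ; *-zeroʳ; *-assoc;
         *-distribˡ-+; *-inverseˡ; ≤-refl; ≤-reflexive; <-≤-trans; nonNegative⁻¹; positive⁻¹;
         nonNeg*nonNeg⇒nonNeg; pos⇒nonNeg; pos⇒nonZero; 1/pos⇒pos; +-*-commutativeRing; module ≤-Reasoning)
open import Data.Vec using (Vec; []; _∷_; map; lookup; tabulate)
open import Data.Vec.Properties using (≡-dec; map-∘; map-cong; map-id; lookup-map; lookup∘tabulate)
open import Function using (_∘_; id)
open import Function.Definitions using (Injective)
open import Relation.Binary.Definitions using (DecidableEquality)
open import Relation.Binary.PropositionalEquality
open import Relation.Nullary using (Dec; yes; no; does; ¬_; _×-dec_; contradiction)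
open import Relation.Nullary.Decidable using (map′)
open import Algebra.Properties.CommutativeSemigroup
  (CommutativeRing.+-commutativeSemigroup +-*-commutativeRing) using () renaming (interchange to +-interchange)
open import Algebra.Properties.CommutativeSemigroup
  (CommutativeRing.*-commutativeSemigroup +-*-commutativeRing) using () renaming (x∙yz≈y∙xz to *-left-comm)

∑ : {X : Set} → List X → (X → ℚ) → ℚ
∑ xs f = sumℚ (List.map f xs)

infix 5 ∑
syntax ∑ xs (λ x → e) = ∑[ x ∈ xs ] e

module _ {X : Set} where

  ∑-cong : (xs : List X) {f g : X → ℚ} → (∀ x → f x ≡ g x) → ∑ xs f ≡ ∑ xs g
  ∑-cong xs f≗g = cong sumℚ (List.map-cong f≗g xs)

  ∑-zero : (xs : List X) → ∑[ x ∈ xs ] 0ℚ ≡ 0ℚ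
  ∑-zero []       = refl
  ∑-zero (x ∷ xs) = trans (+-identityˡ _) (∑-zero xs)

  ∑-distrib-+ : (xs : List X) (f g : X → ℚ) → ∑[ x ∈ xs ] (f x + g x) ≡ ∑ xs f + ∑ xs g
  ∑-distrib-+ []       f g = sym (+-identityʳ 0ℚ)
  ∑-distrib-+ (x ∷ xs) f g =
    trans (cong (f x + g x +_) (∑-distrib-+ xs f g)) (+-interchange (f x) (g x) (∑ xs f) (∑ xs g))

  *-distribˡ-∑ : (c : ℚ) (xs : List X) (f : X → ℚ) → c * ∑ xs f ≡ ∑[ x ∈ xs ] c * f x
  *-distribˡ-∑ c []       f = *-zeroʳ c
  *-distribˡ-∑ c (x ∷ xs) f = trans (*-distribˡ-+ c (f x) _) (cong (c * f x +_) (*-distribˡ-∑ c xs f))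

  ∑-mono-≤ : (xs : List X) {f g : X → ℚ} → (∀ x → f x ≤ g x) → ∑ xs f ≤ ∑ xs g
  ∑-mono-≤ []       f≤g = ≤-refl
  ∑-mono-≤ (x ∷ xs) f≤g = +-mono-≤ (f≤g x) (∑-mono-≤ xs f≤g)

  ∑-nonneg : (xs : List X) {f : X → ℚ} → (∀ x → 0ℚ ≤ f x) → 0ℚ ≤ ∑ xs f
  ∑-nonneg xs {f} f≥0 = subst (_≤ ∑ xs f) (∑-zero xs) (∑-mono-≤ xs f≥0)

  ∑-++ : (xs ys : List X) (f : X → ℚ) → ∑ (xs ++ ys) f ≡ ∑ xs f + ∑ ys f
  ∑-++ []       ys f = sym (+-identityˡ _)
  ∑-++ (x ∷ xs) ys f = trans (cong (f x +_) (∑-++ xs ys f)) (sym (+-assoc (f x) _ _))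

  ∑-map : {Y : Set} (h : Y → X) (ys : List Y) (f : X → ℚ) → ∑ (List.map h ys) f ≡ ∑[ y ∈ ys ] f (h y)
  ∑-map h ys f = cong sumℚ (sym (List.map-∘ ys))

  ∑-concatMap : {Y : Set} (h : Y → List X) (ys : List Y) (f : X → ℚ) →
    ∑ (concatMap h ys) f ≡ ∑[ y ∈ ys ] ∑ (h y) f
  ∑-concatMap h []       f = refl
  ∑-concatMap h (y ∷ ys) f = trans (∑-++ (h y) _ f) (cong (∑ (h y) f +_) (∑-concatMap h ys f))

∑-comm : {X Y : Set} (xs : List X) (ys : List Y) (f : X → Y → ℚ) →
  ∑[ x ∈ xs ] ∑[ y ∈ ys ] f x y ≡ ∑[ y ∈ ys ] ∑[ x ∈ xs ] f x y
∑-comm []       ys f = sym (∑-zero ys)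
∑-comm (x ∷ xs) ys f =
  trans (cong (∑ ys (f x) +_) (∑-comm xs ys f)) (sym (∑-distrib-+ ys (f x) _))

private variable
  P Q : Set

𝟙 : Dec P → ℚ
𝟙 d = if does d then 1ℚ else 0ℚ

𝟙-nonneg : (d : Dec P) → 0ℚ ≤ 𝟙 d
𝟙-nonneg (yes _) = nonNegative⁻¹ 1ℚ
𝟙-nonneg (no _)  = ≤-refl

𝟙-yes : (d : Dec P) → P → 𝟙 d ≡ 1ℚ
𝟙-yes (yes _) _ = refl
𝟙-yes (no ¬p) p = contradiction p ¬p

𝟙-no : (d : Dec P) → ¬ P → 𝟙 d ≡ 0ℚ
𝟙-no (yes p) ¬p = contradiction p ¬p
𝟙-no (no _)  _  = refl

𝟙-cong : (d : Dec P) (e : Dec Q) → (P → Q) → (Q → P) → 𝟙 d ≡ 𝟙 e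
𝟙-cong (yes p) e       p→q q→p = sym (𝟙-yes e (p→q p))
𝟙-cong (no ¬p) (yes q) p→q q→p = contradiction (q→p q) ¬p
𝟙-cong (no _)  (no _)  p→q q→p = refl

𝟙-×-dec : (d : Dec P) (e : Dec Q) → 𝟙 (d ×-dec e) ≡ 𝟙 d * 𝟙 e
𝟙-×-dec (yes _) e = sym (*-identityˡ (𝟙 e))
𝟙-×-dec (no _)  e = sym (*-zeroˡ (𝟙 e))

𝟙*-≤ : (d : Dec P) {t : ℚ} → 0ℚ ≤ t → 𝟙 d * t ≤ t
𝟙*-≤ (yes _) {t} _   = ≤-reflexive (*-identityˡ t)
𝟙*-≤ (no _)  {t} t≥0 = subst (_≤ t) (sym (*-zeroˡ t)) t≥0

-- `∑-sift` holds exactly when every element of X occurs once in `elements`.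
record Enumeration (X : Set) : Set where
  field
    _≟_      : DecidableEquality X
    elements : List X
    ∑-sift   : ∀ x (h : X → ℚ) → ∑[ y ∈ elements ] 𝟙 (x ≟ y) * h y ≡ h x

open Enumeration ⦃ ... ⦄

∑-allFin-suc : ∀ n (f : Fin (ℕ.suc n) → ℚ) → ∑ (allFin (ℕ.suc n)) f ≡ f zero + (∑[ j ∈ allFin n ] f (suc j))
∑-allFin-suc n f = cong (λ fs → f zero + sumℚ fs)
  (trans (List.map-tabulate suc f) (sym (List.map-tabulate (λ j → j) (f ∘ suc))))

∑-sift-allFin : ∀ n (c : Fin n) (h : Fin n → ℚ) → ∑[ j ∈ allFin n ] 𝟙 (c ≟ᶠ j) * h j ≡ h c
∑-sift-allFin (ℕ.suc n) zero h = begin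
  ∑[ j ∈ allFin (ℕ.suc n) ] 𝟙 (zero ≟ᶠ j) * h j  ≡⟨ ∑-allFin-suc n (λ j → 𝟙 (zero ≟ᶠ j) * h j) ⟩
  1ℚ * h zero + (∑[ j ∈ allFin n ] 0ℚ * h (suc j))
    ≡⟨ cong₂ _+_ (*-identityˡ (h zero)) (trans (∑-cong (allFin n) (λ j → *-zeroˡ (h (suc j)))) (∑-zero (allFin n))) ⟩
  h zero + 0ℚ                                     ≡⟨ +-identityʳ _ ⟩
  h zero                                          ∎
  where open ≡-Reasoning
∑-sift-allFin (ℕ.suc n) (suc c) h = begin
  ∑[ j ∈ allFin (ℕ.suc n) ] 𝟙 (suc c ≟ᶠ j) * h j        ≡⟨ ∑-allFin-suc n (λ j → 𝟙 (suc c ≟ᶠ j) * h j) ⟩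
  0ℚ * h zero + (∑[ j ∈ allFin n ] 𝟙 (c ≟ᶠ j) * h (suc j)) ≡⟨ cong₂ _+_ (*-zeroˡ (h zero)) (∑-sift-allFin n c (h ∘ suc)) ⟩
  0ℚ + h (suc c)                                          ≡⟨ +-identityˡ _ ⟩
  h (suc c)                                               ∎
  where open ≡-Reasoning

∑-sift-allVecs : ∀ k n (w : Vec (Fin n) k) (h : Vec (Fin n) k → ℚ) →
  ∑[ v ∈ allVecs k n ] 𝟙 (≡-dec _≟ᶠ_ w v) * h v ≡ h w
∑-sift-allVecs ℕ.zero    n []      h = trans (+-identityʳ _) (*-identityˡ _)
∑-sift-allVecs (ℕ.suc k) n (d ∷ w) h = begin
  ∑[ v ∈ allVecs (ℕ.suc k) n ] 𝟙 (≡-dec _≟ᶠ_ (d ∷ w) v) * h v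
    ≡⟨ ∑-concatMap _ (allFin n) _ ⟩
  ∑[ c ∈ allFin n ] ∑ (List.map (c ∷_) (allVecs k n)) (λ v → 𝟙 (≡-dec _≟ᶠ_ (d ∷ w) v) * h v)
    ≡⟨ ∑-cong (allFin n) (λ c → ∑-map (c ∷_) (allVecs k n) _) ⟩
  ∑[ c ∈ allFin n ] ∑[ a ∈ allVecs k n ] 𝟙 ((d ≟ᶠ c) ×-dec ≡-dec _≟ᶠ_ w a) * h (c ∷ a)
    ≡⟨ ∑-cong (allFin n) (λ c → ∑-cong (allVecs k n) (λ a → split c a)) ⟩
  ∑[ c ∈ allFin n ] ∑[ a ∈ allVecs k n ] 𝟙 (d ≟ᶠ c) * (𝟙 (≡-dec _≟ᶠ_ w a) * h (c ∷ a))
    ≡⟨ ∑-cong (allFin n) (λ c → sym (*-distribˡ-∑ (𝟙 (d ≟ᶠ c)) (allVecs k n) _)) ⟩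
  ∑[ c ∈ allFin n ] 𝟙 (d ≟ᶠ c) * (∑[ a ∈ allVecs k n ] 𝟙 (≡-dec _≟ᶠ_ w a) * h (c ∷ a))
    ≡⟨ ∑-cong (allFin n) (λ c → cong (𝟙 (d ≟ᶠ c) *_) (∑-sift-allVecs k n w (h ∘ (c ∷_)))) ⟩
  ∑[ c ∈ allFin n ] 𝟙 (d ≟ᶠ c) * h (c ∷ w)
    ≡⟨ ∑-sift-allFin n d (λ c → h (c ∷ w)) ⟩
  h (d ∷ w) ∎
  where
  open ≡-Reasoning
  split : ∀ c a → 𝟙 ((d ≟ᶠ c) ×-dec ≡-dec _≟ᶠ_ w a) * h (c ∷ a) ≡ 𝟙 (d ≟ᶠ c) * (𝟙 (≡-dec _≟ᶠ_ w a) * h (c ∷ a))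
  split c a = trans (cong (_* h (c ∷ a)) (𝟙-×-dec (d ≟ᶠ c) (≡-dec _≟ᶠ_ w a)))
                    (*-assoc (𝟙 (d ≟ᶠ c)) (𝟙 (≡-dec _≟ᶠ_ w a)) (h (c ∷ a)))

instance
  Fin-enumeration : ∀ {n} → Enumeration (Fin n)
  Fin-enumeration {n} = record { _≟_ = _≟ᶠ_ ; elements = allFin n ; ∑-sift = ∑-sift-allFin n }

  Vec-enumeration : ∀ {k n} → Enumeration (Vec (Fin n) k)
  Vec-enumeration {k} {n} = record { _≟_ = ≡-dec _≟ᶠ_ ; elements = allVecs k n ; ∑-sift = ∑-sift-allVecs k n }

*-nonneg : {a b : ℚ} → 0ℚ ≤ a → 0ℚ ≤ b → 0ℚ ≤ a * b
*-nonneg {a} {b} a≥0 b≥0 =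
  nonNegative⁻¹ (a * b) ⦃ nonNeg*nonNeg⇒nonNeg a ⦃ nonNegative a≥0 ⦄ b ⦃ nonNegative b≥0 ⦄ ⦄

∑-reindex : {X : Set} ⦃ _ : Enumeration X ⦄ (φ ψ : X → X) →
  (∀ x → ψ (φ x) ≡ x) → (∀ x → φ (ψ x) ≡ x) →
  (h : X → ℚ) → ∑[ x ∈ elements ] h (φ x) ≡ ∑ elements h
∑-reindex φ ψ ψφ φψ h = begin
  ∑[ x ∈ elements ] h (φ x)                               ≡⟨ ∑-cong elements (λ x → sym (∑-sift (φ x) h)) ⟩
  ∑[ x ∈ elements ] ∑[ y ∈ elements ] 𝟙 (φ x ≟ y) * h y  ≡⟨ ∑-comm elements elements (λ x y → 𝟙 (φ x ≟ y) * h y) ⟩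
  ∑[ y ∈ elements ] ∑[ x ∈ elements ] 𝟙 (φ x ≟ y) * h y  ≡⟨ ∑-cong elements (λ y → ∑-cong elements (λ x →
                                                               cong (_* h y) (inverted x y))) ⟩
  ∑[ y ∈ elements ] ∑[ x ∈ elements ] 𝟙 (ψ y ≟ x) * h y  ≡⟨ ∑-cong elements (λ y → ∑-sift (ψ y) (λ _ → h y)) ⟩
  ∑ elements h                                            ∎
  where
  open ≡-Reasoning
  inverted : ∀ x y → 𝟙 (φ x ≟ y) ≡ 𝟙 (ψ y ≟ x)
  inverted x y = 𝟙-cong (φ x ≟ y) (ψ y ≟ x)
    (λ φx≡y → trans (cong ψ (sym φx≡y)) (ψφ x)) (λ ψy≡x → trans (cong φ (sym ψy≡x)) (φψ y))

IsDistribution : {X : Set} → List X → (X → ℚ) → Set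
IsDistribution xs w = (∀ x → 0ℚ ≤ w x) × ∑ xs w ≡ 1ℚ

mixture-distribution : {V D : Set} (vs : List V) (ds : List D) {c : V → ℚ} {w : V → D → ℚ} →
  IsDistribution vs c → (∀ v → IsDistribution ds (w v)) →
  IsDistribution ds (λ d → ∑[ v ∈ vs ] c v * w v d)
mixture-distribution vs ds {c} {w} (c≥0 , ∑c≡1) w-dist =
  (λ d → ∑-nonneg vs (λ v → *-nonneg (c≥0 v) (proj₁ (w-dist v) d))) , sums-to-1
  where
  open ≡-Reasoning
  sums-to-1 : ∑[ d ∈ ds ] ∑[ v ∈ vs ] c v * w v d ≡ 1ℚ
  sums-to-1 = begin
    ∑[ d ∈ ds ] ∑[ v ∈ vs ] c v * w v d  ≡⟨ ∑-comm ds vs _ ⟩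
    ∑[ v ∈ vs ] ∑[ d ∈ ds ] c v * w v d  ≡⟨ ∑-cong vs (λ v → sym (*-distribˡ-∑ (c v) ds (w v))) ⟩
    ∑[ v ∈ vs ] c v * ∑ ds (w v)         ≡⟨ ∑-cong vs (λ v → trans (cong (c v *_) (proj₂ (w-dist v))) (*-identityʳ (c v))) ⟩
    ∑ vs c                               ≡⟨ ∑c≡1 ⟩
    1ℚ                                   ∎

push : {X Y : Set} ⦃ _ : Enumeration X ⦄ ⦃ _ : Enumeration Y ⦄ → (X → Y) → (X → ℚ) → Y → ℚ
push f w y = ∑[ x ∈ elements ] 𝟙 (f x ≟ y) * w x

module _ {X Y : Set} ⦃ _ : Enumeration X ⦄ ⦃ _ : Enumeration Y ⦄ where

  push-congˡ : {f f′ : X → Y} {w : X → ℚ} → (∀ x → f x ≡ f′ x) → ∀ y → push f w y ≡ push f′ w y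
  push-congˡ {w = w} f≗f′ y = ∑-cong elements (λ x → cong (λ z → 𝟙 (z ≟ y) * w x) (f≗f′ x))

  push-congʳ : (f : X → Y) {w w′ : X → ℚ} → (∀ x → w x ≡ w′ x) → ∀ y → push f w y ≡ push f w′ y
  push-congʳ f w≗w′ y = ∑-cong elements (λ x → cong (𝟙 (f x ≟ y) *_) (w≗w′ x))

  push-total : (f : X → Y) (w : X → ℚ) → ∑[ y ∈ elements ] push f w y ≡ ∑ elements w
  push-total f w = trans (∑-comm elements elements (λ y x → 𝟙 (f x ≟ y) * w x)) (∑-cong elements (λ x → ∑-sift (f x) (λ _ → w x)))

  push-distribution : (f : X → Y) {w : X → ℚ} → IsDistribution elements w → IsDistribution elements (push f w)
  push-distribution f {w} (w≥0 , ∑w≡1) =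
    (λ y → ∑-nonneg elements (λ x → *-nonneg (𝟙-nonneg (f x ≟ y)) (w≥0 x))) , trans (push-total f w) ∑w≡1

  push-mixture : {V : Set} (f : X → Y) (vs : List V) (c : V → ℚ) (w : V → X → ℚ) →
    ∀ y → push f (λ x → ∑[ v ∈ vs ] c v * w v x) y ≡ ∑[ v ∈ vs ] c v * push f (w v) y
  push-mixture f vs c w y = begin
    ∑[ x ∈ elements ] 𝟙 (f x ≟ y) * (∑[ v ∈ vs ] c v * w v x)
      ≡⟨ ∑-cong elements (λ x → *-distribˡ-∑ (𝟙 (f x ≟ y)) vs _) ⟩
    ∑[ x ∈ elements ] ∑[ v ∈ vs ] 𝟙 (f x ≟ y) * (c v * w v x)
      ≡⟨ ∑-cong elements (λ x → ∑-cong vs (λ v → *-left-comm (𝟙 (f x ≟ y)) (c v) (w v x))) ⟩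
    ∑[ x ∈ elements ] ∑[ v ∈ vs ] c v * (𝟙 (f x ≟ y) * w v x)
      ≡⟨ ∑-comm elements vs (λ x v → c v * (𝟙 (f x ≟ y) * w v x)) ⟩
    ∑[ v ∈ vs ] ∑[ x ∈ elements ] c v * (𝟙 (f x ≟ y) * w v x)
      ≡⟨ ∑-cong vs (λ v → sym (*-distribˡ-∑ (c v) elements (λ x → 𝟙 (f x ≟ y) * w v x))) ⟩
    ∑[ v ∈ vs ] c v * push f (w v) y ∎
    where open ≡-Reasoning

  module _ {Z : Set} ⦃ _ : Enumeration Z ⦄ where

    push-∘ : (g : Y → Z) (f : X → Y) (w : X → ℚ) → ∀ z → push g (push f w) z ≡ push (g ∘ f) w z
    push-∘ g f w z = begin
      ∑[ y ∈ elements ] 𝟙 (g y ≟ z) * (∑[ x ∈ elements ] 𝟙 (f x ≟ y) * w x)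
        ≡⟨ ∑-cong elements (λ y → *-distribˡ-∑ (𝟙 (g y ≟ z)) elements (λ x → 𝟙 (f x ≟ y) * w x)) ⟩
      ∑[ y ∈ elements ] ∑[ x ∈ elements ] 𝟙 (g y ≟ z) * (𝟙 (f x ≟ y) * w x)
        ≡⟨ ∑-cong elements (λ y → ∑-cong elements (λ x → *-left-comm (𝟙 (g y ≟ z)) (𝟙 (f x ≟ y)) (w x))) ⟩
      ∑[ y ∈ elements ] ∑[ x ∈ elements ] 𝟙 (f x ≟ y) * (𝟙 (g y ≟ z) * w x)
        ≡⟨ ∑-comm elements elements (λ y x → 𝟙 (f x ≟ y) * (𝟙 (g y ≟ z) * w x)) ⟩
      ∑[ x ∈ elements ] ∑[ y ∈ elements ] 𝟙 (f x ≟ y) * (𝟙 (g y ≟ z) * w x)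
        ≡⟨ ∑-cong elements (λ x → ∑-sift (f x) (λ y → 𝟙 (g y ≟ z) * w x)) ⟩
      push (g ∘ f) w z ∎
      where open ≡-Reasoning

    push-injective : {h : Y → Z} → Injective _≡_ _≡_ h → (f : X → Y) (w : X → ℚ) →
      ∀ y → push (h ∘ f) w (h y) ≡ push f w y
    push-injective {h} h-inj f w y =
      ∑-cong elements (λ x → cong (_* w x) (𝟙-cong (h (f x) ≟ h y) (f x ≟ y) h-inj (cong h)))

module Uniform {X : Set} ⦃ _ : Enumeration X ⦄ {P : X → Set} (P? : ∀ x → Dec (P x)) {x₀ : X} (Px₀ : P x₀) where

  count : ℚ
  count = ∑[ x ∈ elements ] 𝟙 (P? x)

  count-positive : Positive count
  count-positive = positive (<-≤-trans (positive⁻¹ 1ℚ) 1≤count)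
    where
    open ≤-Reasoning
    1≤count : 1ℚ ≤ count
    1≤count = begin
      1ℚ                                       ≡⟨ 𝟙-yes (P? x₀) Px₀ ⟨
      𝟙 (P? x₀)                                ≡⟨ ∑-sift x₀ (λ x → 𝟙 (P? x)) ⟨
      ∑[ x ∈ elements ] 𝟙 (x₀ ≟ x) * 𝟙 (P? x) ≤⟨ ∑-mono-≤ elements (λ x → 𝟙*-≤ (x₀ ≟ x) (𝟙-nonneg (P? x))) ⟩
      count                                    ∎

  instance
    count-nonZero : NonZero count
    count-nonZero = pos⇒nonZero count ⦃ count-positive ⦄

  uniform : X → ℚ
  uniform x = 1/ count * 𝟙 (P? x)

  uniform-distribution : IsDistribution elements uniform
  uniform-distribution =
    (λ x → *-nonneg 1/count≥0 (𝟙-nonneg (P? x))) ,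
    trans (sym (*-distribˡ-∑ (1/ count) elements (λ x → 𝟙 (P? x)))) (*-inverseˡ count)
    where
    1/count≥0 : 0ℚ ≤ 1/ count
    1/count≥0 = nonNegative⁻¹ (1/ count) ⦃ pos⇒nonNeg (1/ count) ⦃ 1/pos⇒pos count ⦃ count-positive ⦄ ⦄ ⦄

  uniform-cong : ∀ x y → (P x → P y) → (P y → P x) → uniform x ≡ uniform y
  uniform-cong x y Px→Py Py→Px = cong (1/ count *_) (𝟙-cong (P? x) (P? y) Px→Py Py→Px)

  uniform-*-cong : ∀ x {s t : ℚ} → (P x → s ≡ t) → uniform x * s ≡ uniform x * t
  uniform-*-cong x {s} {t} s≡t = by-cases (P? x)
    where
    vanishes : ¬ P x → ∀ r → uniform x * r ≡ 0ℚ
    vanishes ¬Px r = trans (cong (λ u → 1/ count * u * r) (𝟙-no (P? x) ¬Px))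
                           (trans (cong (_* r) (*-zeroʳ (1/ count))) (*-zeroˡ r))
    by-cases : Dec (P x) → uniform x * s ≡ uniform x * t
    by-cases (yes Px) = cong (uniform x *_) (s≡t Px)
    by-cases (no ¬Px) = trans (vanishes ¬Px s) (sym (vanishes ¬Px t))

map-inverse : {A : Set} {n : ℕ} {f f⁻¹ : A → A} → (∀ a → f⁻¹ (f a) ≡ a) → (v : Vec A n) → map f⁻¹ (map f v) ≡ v
map-inverse {f = f} {f⁻¹} inverse v = trans (sym (map-∘ f⁻¹ f v)) (trans (map-cong inverse v) (map-id v))

proj-map : {B C : Set} {r k : ℕ} (h : B → C) (b : Vec B r) (i : Vec (Fin r) k) → proj (map h b) i ≡ map h (proj b i)
proj-map h b i = trans (map-cong (λ t → lookup-map t h b) i) (map-∘ h (lookup b) i)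

module _ {σ : Signature} where

  isHom? : (A B : Structure σ) (h : Fin (size A) → Fin (size B)) → Dec (IsHom A B h)
  isHom? A B h = all? λ R →
    map′ (λ images b b∈ → All.lookup images b∈) (λ images → All.tabulate (images _))
         (All.all? (λ b → Any.any? (≡-dec _≟ᶠ_ (map h b)) (rel B R)) (rel A R))

  IsHom-id : (A : Structure σ) → IsHom A A id
  IsHom-id A R b b∈ = subst (_∈ rel A R) (sym (map-id b)) b∈

  IsHom-∘ : {A B C : Structure σ} {g : Fin (size B) → Fin (size C)} {f : Fin (size A) → Fin (size B)} →
    IsHom B C g → IsHom A B f → IsHom A C (g ∘ f)
  IsHom-∘ {C = C} {g} {f} g-hom f-hom R b b∈ =
    subst (_∈ rel C R) (sym (map-∘ g f b)) (g-hom R (map f b) (f-hom R b b∈))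

  IsHom-cong : {A B : Structure σ} {h h′ : Fin (size A) → Fin (size B)} →
    (∀ a → h a ≡ h′ a) → IsHom A B h → IsHom A B h′
  IsHom-cong {B = B} h≗h′ h-hom R b b∈ = subst (_∈ rel B R) (map-cong h≗h′ b) (h-hom R b b∈)

  module _ {A B : Structure σ} {h : Fin (size A) → Fin (size B)} (h-hom : IsHom A B h) (R : Fin (nsym σ)) where

    relIndex : Fin (length (rel A R)) → Fin (length (rel B R))
    relIndex j = Any.index (h-hom R (List.lookup (rel A R) j) (∈-lookup j))

    lookup-relIndex : ∀ j → List.lookup (rel B R) (relIndex j) ≡ map h (List.lookup (rel A R) j)
    lookup-relIndex j = sym (Any.lookup-index (h-hom R (List.lookup (rel A R) j) (∈-lookup j)))

tensor : {k n : ℕ} {w : Vec (Fin n) k → ℚ} → IsDistribution (allVecs k n) w → Tensor k n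
tensor {w = w} (w≥0 , ∑w≡1) = record { entry = w ; nonneg = w≥0 ; total = ∑w≡1 }

tensor-distribution : {k n : ℕ} (T : Tensor k n) → IsDistribution (allVecs k n) (entry T)
tensor-distribution T = nonneg T , total T

probVec : {m : ℕ} {w : Fin m → ℚ} → IsDistribution (allFin m) w → ProbVec m
probVec {w = w} (w≥0 , ∑w≡1) = record { weight = w ; pnonneg = w≥0 ; ptotal = ∑w≡1 }

probVec-distribution : {m : ℕ} (q : ProbVec m) → IsDistribution (allFin m) (weight q)
probVec-distribution q = pnonneg q , ptotal q

pushProbVec : {m m′ : ℕ} → (Fin m → Fin m′) → ProbVec m → ProbVec m′
pushProbVec f q = probVec (push-distribution f (probVec-distribution q))

module _ {σ : Signature} (A : Structure σ) (k : ℕ) (R : Fin (nsym σ)) where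

  tupleProj : Vec (Fin (arity σ R)) k → Fin (length (rel A R)) → Vec (Fin (size A)) k
  tupleProj i j = proj (List.lookup (rel A R) j) i

  -- The summand of `marginal` is a with-function local to Defs; its name cannot be
  -- written here, so the left-hand side of `marginal-summand` is left to unification.
  marginal≡push : (q : ProbVec (length (rel A R))) (i : Vec (Fin (arity σ R)) k) →
    ∀ a → marginal A k R q i a ≡ push (tupleProj i) (weight q) a
  marginal-summand : (q : ProbVec (length (rel A R))) (i : Vec (Fin (arity σ R)) k) (a : Vec (Fin (size A)) k) →
    ∀ j → _≡_ {A = ℚ} _ (𝟙 (≡-dec _≟ᶠ_ (tupleProj i j) a) * weight q j)

  marginal≡push q i a = cong sumℚ (List.map-cong (marginal-summand q i a) (allFin _))
  marginal-summand q i a j with ≡-dec _≟ᶠ_ (tupleProj i j) a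
  ... | yes _ = sym (*-identityˡ (weight q j))
  ... | no _  = sym (*-zeroˡ (weight q j))

marginal-relIndex : {σ : Signature} {A B : Structure σ} {h : Fin (size A) → Fin (size B)} (h-hom : IsHom A B h)
  (k : ℕ) (R : Fin (nsym σ)) (q : ProbVec (length (rel A R))) (i : Vec (Fin (arity σ R)) k) →
  ∀ a → marginal B k R (pushProbVec (relIndex h-hom R) q) i a ≡ push (map h) (marginal A k R q i) a
marginal-relIndex {A = A} {B} {h} h-hom k R q i a = begin
  marginal B k R (pushProbVec (relIndex h-hom R) q) i a
    ≡⟨ marginal≡push B k R _ i a ⟩
  push (tupleProj B k R i) (push (relIndex h-hom R) (weight q)) a
    ≡⟨ push-∘ (tupleProj B k R i) (relIndex h-hom R) (weight q) a ⟩
  push (tupleProj B k R i ∘ relIndex h-hom R) (weight q) a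
    ≡⟨ push-congˡ image-tuple a ⟩
  push (map h ∘ tupleProj A k R i) (weight q) a
    ≡⟨ push-∘ (map h) (tupleProj A k R i) (weight q) a ⟨
  push (map h) (push (tupleProj A k R i) (weight q)) a
    ≡⟨ push-congʳ (map h) (λ a′ → sym (marginal≡push A k R q i a′)) a ⟩
  push (map h) (marginal A k R q i) a ∎
  where
  open ≡-Reasoning
  image-tuple : ∀ j → tupleProj B k R i (relIndex h-hom R j) ≡ map h (tupleProj A k R i j)
  image-tuple j = trans (cong (λ b → proj b i) (lookup-relIndex h-hom R j)) (proj-map h (List.lookup (rel A R) j) i)

module Symmetrisation {σ : Signature} (k : ℕ) (X A : Structure σ) (g : Vec (Fin (size X)) k → Tensor k (size A)) where

  Endo : Vec (Fin (size A)) (size A) → Set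
  Endo v = IsHom A A (lookup v)

  identity-endo : Endo (tabulate id)
  identity-endo = IsHom-cong (λ a → sym (lookup∘tabulate id a)) (IsHom-id A)

  open Uniform (λ v → isHom? A A (lookup v)) {tabulate id} identity-endo

  ḡ : Vec (Fin (size X)) k → Tensor k (size A)
  ḡ y = tensor (mixture-distribution elements elements uniform-distribution
                  (λ v → push-distribution (map (lookup v)) (tensor-distribution (g y))))

  ḡ-invariant : (y : Vec (Fin (size X)) k) (a : Vec (Fin (size A)) k) (θ : Fin (size A) → Fin (size A)) →
    IsAutomorphism A θ → entry (ḡ y) a ≡ entry (ḡ y) (map θ a)
  ḡ-invariant y a θ θ-aut = sym (begin
    ∑[ v ∈ elements ] uniform v * push (map (lookup v)) G (map θ a)
      ≡⟨ ∑-reindex (map θ) (map inv) (map-inverse left) (map-inverse right) summand ⟨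
    ∑[ v ∈ elements ] uniform (map θ v) * push (map (lookup (map θ v))) G (map θ a)
      ≡⟨ ∑-cong elements (λ v → cong₂ _*_ (uniform-cong (map θ v) v (endo-from v) (endo-to v)) (push-postcompose v)) ⟩
    ∑[ v ∈ elements ] uniform v * push (map (lookup v)) G a ∎)
    where
    open ≡-Reasoning
    open IsAutomorphism θ-aut
    G : Vec (Fin (size A)) k → ℚ
    G = entry (g y)
    summand : Vec (Fin (size A)) (size A) → ℚ
    summand v = uniform v * push (map (lookup v)) G (map θ a)
    lookup-map-θ : ∀ v i → lookup (map θ v) i ≡ θ (lookup v i)
    lookup-map-θ v i = lookup-map i θ v
    endo-from : ∀ v → Endo (map θ v) → Endo v
    endo-from v θv-hom = IsHom-cong (λ i → trans (cong inv (lookup-map-θ v i)) (left (lookup v i))) (IsHom-∘ inv-hom θv-hom)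
    endo-to : ∀ v → Endo v → Endo (map θ v)
    endo-to v v-hom = IsHom-cong (λ i → sym (lookup-map-θ v i)) (IsHom-∘ hom v-hom)
    map-θ-injective : ∀ {u w : Vec (Fin (size A)) k} → map θ u ≡ map θ w → u ≡ w
    map-θ-injective {u} {w} θu≡θw = trans (sym (map-inverse left u)) (trans (cong (map inv) θu≡θw) (map-inverse left w))
    push-postcompose : ∀ v → push (map (lookup (map θ v))) G (map θ a) ≡ push (map (lookup v)) G a
    push-postcompose v = trans
      (push-congˡ (λ a′ → trans (map-cong (lookup-map-θ v) a′) (map-∘ θ (lookup v) a′)) (map θ a))
      (push-injective map-θ-injective (map (lookup v)) G a)

  -- For a non-endomorphism the value is irrelevant: its uniform weight is 0.
  endoImage : (R : Fin (nsym σ)) → ProbVec (length (rel A R)) → Vec (Fin (size A)) (size A) → ProbVec (length (rel A R))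
  endoImage R q v with isHom? A A (lookup v)
  ... | yes v-hom = pushProbVec (relIndex v-hom R) q
  ... | no _      = q

  endoImage-marginal : (R : Fin (nsym σ)) (q : ProbVec (length (rel A R))) (v : Vec (Fin (size A)) (size A)) → Endo v →
    ∀ i a → marginal A k R (endoImage R q v) i a ≡ push (map (lookup v)) (marginal A k R q i) a
  endoImage-marginal R q v v-hom i a with isHom? A A (lookup v)
  ... | yes v-hom′ = marginal-relIndex v-hom′ k R q i a
  ... | no ¬v-hom  = contradiction v-hom ¬v-hom

  averagedProbVec : (R : Fin (nsym σ)) → ProbVec (length (rel A R)) → ProbVec (length (rel A R))
  averagedProbVec R q = probVec (mixture-distribution elements elements uniform-distribution
                                   (λ v → probVec-distribution (endoImage R q v)))

  averagedProbVec-marginal : (R : Fin (nsym σ)) (x : Vec (Fin (size X)) (arity σ R)) (q : ProbVec (length (rel A R))) →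
    (∀ i a → entry (g (proj x i)) a ≡ marginal A k R q i a) →
    ∀ i a → entry (ḡ (proj x i)) a ≡ marginal A k R (averagedProbVec R q) i a
  averagedProbVec-marginal R x q q-marginal i a = sym (begin
    marginal A k R (averagedProbVec R q) i a
      ≡⟨ marginal≡push A k R (averagedProbVec R q) i a ⟩
    push (tupleProj A k R i) (weight (averagedProbVec R q)) a
      ≡⟨ push-mixture (tupleProj A k R i) elements uniform (λ v → weight (endoImage R q v)) a ⟩
    ∑[ v ∈ elements ] uniform v * push (tupleProj A k R i) (weight (endoImage R q v)) a
      ≡⟨ ∑-cong elements (λ v → uniform-*-cong v (endoImage-push v)) ⟩
    ∑[ v ∈ elements ] uniform v * push (map (lookup v)) (entry (g (proj x i))) a ∎)
    where
    open ≡-Reasoning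
    endoImage-push : ∀ v → Endo v →
      push (tupleProj A k R i) (weight (endoImage R q v)) a ≡ push (map (lookup v)) (entry (g (proj x i))) a
    endoImage-push v v-hom = begin
      push (tupleProj A k R i) (weight (endoImage R q v)) a ≡⟨ marginal≡push A k R (endoImage R q v) i a ⟨
      marginal A k R (endoImage R q v) i a                 ≡⟨ endoImage-marginal R q v v-hom i a ⟩
      push (map (lookup v)) (marginal A k R q i) a          ≡⟨ push-congʳ (map (lookup v)) (λ a′ → sym (q-marginal i a′)) a ⟩
      push (map (lookup v)) (entry (g (proj x i))) a        ∎

  ḡ-hom : IsHomTensorF k X A g → IsHomTensorF k X A ḡ
  ḡ-hom g-hom R x x∈ =
    let q , q-marginal = g-hom R x x∈ in averagedProbVec R q , averagedProbVec-marginal R x q q-marginal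

proposition5p10 : {σ : Signature} (k : ℕ) (X A : Structure σ) →
    Σ (Vec (Fin (size X)) k → Tensor k (size A)) (IsHomTensorF k X A) →
    Σ (Vec (Fin (size X)) k → Tensor k (size A)) λ ḡ →
      IsHomTensorF k X A ḡ ×
      ((x : Vec (Fin (size X)) k) (a : Vec (Fin (size A)) k)
        (θ : Fin (size A) → Fin (size A)) → IsAutomorphism A θ →
        entry (ḡ x) a ≡ entry (ḡ x) (map θ a))
proposition5p10 k X A (g , g-hom) = ḡ , ḡ-hom g-hom , ḡ-invariant
  where open Symmetrisation k X A g
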